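{- Let $(V,\mathcal{C})$ be an instance of 3-Compatible Colouring with colours $\{\mathcal{X},\mathcal{Y},\mathcal{Z}\}$ (three distinct colours). Suppose $V$ contains four vertices $g_1,g_2,g_3,g_4$ forming a type one $\mathcal{Y}$-gadget, i.e. $\mathcal{C}(g_1g_2)=\mathcal{C}(g_3g_4)=\alpha$ and $\mathcal{C}(g_1g_3)=\mathcal{C}(g_1g_4)=\mathcal{C}(g_2g_3)=\mathcal{C}(g_2g_4)=\beta$, where $\{\alpha,\beta\}=\{\mathcal{X},\mathcal{Z}\}$, and for every other vertex $v\in V$ the four edges $g_iv$ all have the same colour, which is either $\mathcal{Y}$ or $\mathcal{X}$-... more precisely either $\mathcal{Y}$ or one fixed colour of $\{\mathcal{X},\mathcal{Z}\}$ . Let $u,w \in V\setminus\{g_1,g_2,g_3,g_4\}$ be distinct. Let $(V',\mathcal{C}')$ be obtained by adding two new vertices $v_0,v_1$ with $\mathcal{C}'(uv_0)=\mathcal{C}'(wv_1)=\mathcal{X}$, $\mathcal{C}'(uv_1)=\mathcal{C}'(wv_0)=\mathcal{Y}$, $\mathcal{C}'(v_0v_1)=\mathcal{Z}$, and all other edges between $\{v_0,v_1\}$ and $V$ (in particular all edges to $g_1,\dots,g_4$) coloured $\mathcal{Y}$. Then $(V',\mathcal{C}')$ has a feasible colouring if and only if $(V,\mathcal{C})$ has a feasible colouring in which at least one of $u,w$ is not of colour $\mathcal{X}$.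
   Context: An instance of 3-Compatible Colouring is a finite vertex set $V$ with a colouring $\mathcal{C}$ of all edges of the complete graph on $V$ with three colours; a feasible colouring is a map $\phi$ from $V$ to the three colours such that no edge $uv$ satisfies $\phi(u)=\phi(v)=\mathcal{C}(uv)$. The relevant property of the type one $\mathcal{Y}$-gadget is that in every feasible colouring at least one of $g_1,\dots,g_4$ receives colour $\mathcal{Y}$. -}

module Defs where

open import Data.Nat using (ℕ; suc)
open import Data.Fin using (Fin; zero; suc; _≟_)
open import Data.Product using (Σ; _×_; ∃)
open import Data.Sum using (_⊎_)
open import Relation.Binary.PropositionalEquality using (_≡_; _≢_)
open import Relation.Nullary using (¬_; yes; no)

data Colour : Set where
  X Y Z : Colour

-- An edge colouring of the complete graph on the vertex set Fin n.
-- Values on the diagonal (C a a) are irrelevant; symmetry is imposed as a hypothesis.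
EdgeColouring : ℕ → Set
EdgeColouring n = Fin n → Fin n → Colour

Symmetric : ∀ {n} → EdgeColouring n → Set
Symmetric C = ∀ a b → C a b ≡ C b a

Feasible : ∀ {n} → EdgeColouring n → (Fin n → Colour) → Set
Feasible {n} C φ = ∀ (a b : Fin n) → a ≢ b → ¬ (φ a ≡ C a b × φ b ≡ C a b)

HasFeasible : ∀ {n} → EdgeColouring n → Set
HasFeasible {n} C = Σ (Fin n → Colour) (λ φ → Feasible C φ)

TypeOneYGadget : ∀ {n} → EdgeColouring n → (g₁ g₂ g₃ g₄ : Fin n) → Set
TypeOneYGadget {n} C g₁ g₂ g₃ g₄ =
  (g₁ ≢ g₂ × g₁ ≢ g₃ × g₁ ≢ g₄ × g₂ ≢ g₃ × g₂ ≢ g₄ × g₃ ≢ g₄)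
  × (Σ Colour λ α → Σ Colour λ β →
       ((α ≡ X × β ≡ Z) ⊎ (α ≡ Z × β ≡ X))
       × C g₁ g₂ ≡ α × C g₃ g₄ ≡ α
       × C g₁ g₃ ≡ β × C g₁ g₄ ≡ β × C g₂ g₃ ≡ β × C g₂ g₄ ≡ β)
  × (Σ Colour λ γ → (γ ≡ X ⊎ γ ≡ Z)
       × (∀ (v : Fin n) → v ≢ g₁ → v ≢ g₂ → v ≢ g₃ → v ≢ g₄ →
            Σ Colour λ c → (c ≡ Y ⊎ c ≡ γ)
              × C g₁ v ≡ c × C g₂ v ≡ c × C g₃ v ≡ c × C g₄ v ≡ c))

v₀Edge : ∀ {n} → (u w a : Fin n) → Colour
v₀Edge u w a with a ≟ u
... | yes _ = X
... | no _ = Y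

v₁Edge : ∀ {n} → (u w a : Fin n) → Colour
v₁Edge u w a with a ≟ w
... | yes _ = X
... | no _ = Y

-- Extended instance on Fin (2 + n): zero = v₀, suc zero = v₁, suc (suc a) = old vertex a.
extend : ∀ {n} → EdgeColouring n → (u w : Fin n) → EdgeColouring (suc (suc n))
extend C u w zero zero = Y
extend C u w zero (suc zero) = Z
extend C u w zero (suc (suc b)) = v₀Edge u w b
extend C u w (suc zero) zero = Z
extend C u w (suc zero) (suc zero) = Y
extend C u w (suc zero) (suc (suc b)) = v₁Edge u w b
extend C u w (suc (suc a)) zero = v₀Edge u w a
extend C u w (suc (suc a)) (suc zero) = v₁Edge u w a
extend C u w (suc (suc a)) (suc (suc b)) = C a b

-- A new
-- vertex cannot be 𝒴: all its edges to the gadget are 𝒴, while some gadget vertex must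
-- be 𝒴 (a gadget with no 𝒴 vertex is coloured from {α, β}, which its α- and β-edges
-- forbid). As v₀v₁ is a 𝒵-edge, one new vertex is 𝒳, and its 𝒳-edge to u (resp. w)
-- keeps that vertex off 𝒳. Conversely, if u is not 𝒳, colouring v₀ 𝒳 and v₁ 𝒵 is
-- feasible, since v₀ has no other 𝒳-edge and v₁ no 𝒵-edge; symmetrically for w.
module Submission where

open import Defs
open import Data.Nat using (ℕ; _+_)
open import Data.Fin using (Fin; zero; suc; _≟_)
open import Data.Fin.Properties using (suc-injective)
open import Data.Vec.Functional using (_∷_; tail)
open import Data.Product using (Σ; _×_; _,_; proj₁; swap)
open import Data.Sum using (_⊎_; inj₁; inj₂)
open import Data.Empty using (⊥; ⊥-elim)
open import Function using (_∘_)
open import Function.Bundles using (_⇔_; mk⇔)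
open import Relation.Nullary using (¬_; yes; no)
open import Relation.Binary.PropositionalEquality
  using (_≡_; _≢_; refl; sym; trans; cong; ≢-sym)

feasible-edge : ∀ {n} {C : EdgeColouring n} {φ : Fin n → Colour} {a b : Fin n} {c : Colour} →
  Feasible C φ → a ≢ b → C a b ≡ c → φ a ≡ c → φ b ≢ c
feasible-edge {a = a} {b} F a≢b Cab≡c φa≡c φb≡c =
  F a b a≢b (trans φa≡c (sym Cab≡c) , trans φb≡c (sym Cab≡c))

≢Y⇒α⊎β : ∀ {α β c : Colour} → (α ≡ X × β ≡ Z) ⊎ (α ≡ Z × β ≡ X) → c ≢ Y → c ≡ α ⊎ c ≡ β
≢Y⇒α⊎β {c = Y} _ c≢Y = ⊥-elim (c≢Y refl)
≢Y⇒α⊎β {c = X} (inj₁ (refl , refl)) _ = inj₁ refl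
≢Y⇒α⊎β {c = Z} (inj₁ (refl , refl)) _ = inj₂ refl
≢Y⇒α⊎β {c = X} (inj₂ (refl , refl)) _ = inj₂ refl
≢Y⇒α⊎β {c = Z} (inj₂ (refl , refl)) _ = inj₁ refl

typeOneYGadget-forces-Y : ∀ {n} {C : EdgeColouring n} {φ : Fin n → Colour} {g₁ g₂ g₃ g₄ : Fin n} →
  TypeOneYGadget C g₁ g₂ g₃ g₄ → Feasible C φ →
  φ g₁ ≢ Y → φ g₂ ≢ Y → φ g₃ ≢ Y → φ g₄ ≢ Y → ⊥
typeOneYGadget-forces-Y {C = C} {φ} {g₁} {g₂} {g₃} {g₄}
  ((g₁≢g₂ , g₁≢g₃ , g₁≢g₄ , g₂≢g₃ , g₂≢g₄ , g₃≢g₄) , (α , β , αβ , C₁₂ , C₃₄ , C₁₃ , C₁₄ , C₂₃ , C₂₄) , _)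
  F φ₁≢Y φ₂≢Y φ₃≢Y φ₄≢Y = g₁g₂-cases (≢Y⇒α⊎β αβ φ₁≢Y) (≢Y⇒α⊎β αβ φ₂≢Y)
  where
  β-vertex : ∀ {g} → g ≢ g₃ → g ≢ g₄ → C g g₃ ≡ β → C g g₄ ≡ β → φ g ≡ β → ⊥
  β-vertex g≢g₃ g≢g₄ Cg₃ Cg₄ φg≡β with ≢Y⇒α⊎β αβ φ₃≢Y | ≢Y⇒α⊎β αβ φ₄≢Y
  ... | inj₂ φ₃≡β | _         = feasible-edge F g≢g₃ Cg₃ φg≡β φ₃≡β
  ... | _         | inj₂ φ₄≡β = feasible-edge F g≢g₄ Cg₄ φg≡β φ₄≡β
  ... | inj₁ φ₃≡α | inj₁ φ₄≡α = feasible-edge F g₃≢g₄ C₃₄ φ₃≡α φ₄≡α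

  g₁g₂-cases : φ g₁ ≡ α ⊎ φ g₁ ≡ β → φ g₂ ≡ α ⊎ φ g₂ ≡ β → ⊥
  g₁g₂-cases (inj₁ φ₁≡α) (inj₁ φ₂≡α) = feasible-edge F g₁≢g₂ C₁₂ φ₁≡α φ₂≡α
  g₁g₂-cases (inj₂ φ₁≡β) _           = β-vertex g₁≢g₃ g₁≢g₄ C₁₃ C₁₄ φ₁≡β
  g₁g₂-cases (inj₁ _)    (inj₂ φ₂≡β) = β-vertex g₂≢g₃ g₂≢g₄ C₂₃ C₂₄ φ₂≡β

typeOneYGadget-Y-off : ∀ {n} {C : EdgeColouring n} {φ : Fin n → Colour} {g₁ g₂ g₃ g₄ z : Fin n} →
  TypeOneYGadget C g₁ g₂ g₃ g₄ → Feasible C φ →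
  z ≢ g₁ → z ≢ g₂ → z ≢ g₃ → z ≢ g₄ → ¬ (∀ {a} → a ≢ z → φ a ≢ Y)
typeOneYGadget-Y-off G F z≢g₁ z≢g₂ z≢g₃ z≢g₄ Y-free =
  typeOneYGadget-forces-Y G F (Y-free (≢-sym z≢g₁)) (Y-free (≢-sym z≢g₂))
                              (Y-free (≢-sym z≢g₃)) (Y-free (≢-sym z≢g₄))

module _ {n : ℕ} (p q : Fin n) where

  v₀Edge-self : v₀Edge p q p ≡ X
  v₀Edge-self with p ≟ p
  ... | yes _   = refl
  ... | no p≢p = ⊥-elim (p≢p refl)

  v₀Edge-≢ : ∀ {a} → a ≢ p → v₀Edge p q a ≡ Y
  v₀Edge-≢ {a} a≢p with a ≟ p
  ... | yes a≡p = ⊥-elim (a≢p a≡p)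
  ... | no _    = refl

  v₀Edge≡X⇒≡ : ∀ {a} → v₀Edge p q a ≡ X → a ≡ p
  v₀Edge≡X⇒≡ {a} _ with a ≟ p
  v₀Edge≡X⇒≡ _  | yes a≡p = a≡p
  v₀Edge≡X⇒≡ () | no _

  v₀Edge≢Z : ∀ a → v₀Edge p q a ≢ Z
  v₀Edge≢Z a _ with a ≟ p
  v₀Edge≢Z a () | yes _
  v₀Edge≢Z a () | no _

module _ {n : ℕ} (u w : Fin n) where

  v₁Edge≡v₀Edge : ∀ a → v₁Edge u w a ≡ v₀Edge w u a
  v₁Edge≡v₀Edge a with a ≟ w
  ... | yes _ = refl
  ... | no _  = refl

  v₁Edge-self : v₁Edge u w w ≡ X
  v₁Edge-self = trans (v₁Edge≡v₀Edge w) (v₀Edge-self w u)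

  v₁Edge-≢ : ∀ {a} → a ≢ w → v₁Edge u w a ≡ Y
  v₁Edge-≢ {a} a≢w = trans (v₁Edge≡v₀Edge a) (v₀Edge-≢ w u a≢w)

  v₁Edge≡X⇒≡ : ∀ {a} → v₁Edge u w a ≡ X → a ≡ w
  v₁Edge≡X⇒≡ {a} e = v₀Edge≡X⇒≡ w u (trans (sym (v₁Edge≡v₀Edge a)) e)

  v₁Edge≢Z : ∀ a → v₁Edge u w a ≢ Z
  v₁Edge≢Z a = v₀Edge≢Z w u a ∘ trans (sym (v₁Edge≡v₀Edge a))

restrict-feasible : ∀ {n} {C : EdgeColouring n} {u w : Fin n} {ψ : Fin (2 + n) → Colour} →
  Feasible (extend C u w) ψ → Feasible C (tail (tail ψ))
restrict-feasible F a b a≢b = F (suc (suc a)) (suc (suc b)) (a≢b ∘ suc-injective ∘ suc-injective)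

extend-feasible : ∀ {n} {C : EdgeColouring n} {u w : Fin n} {φ : Fin n → Colour} {c₀ c₁ : Colour} →
  Feasible C φ →
  ¬ (c₀ ≡ Z × c₁ ≡ Z) →
  (∀ b → ¬ (c₀ ≡ v₀Edge u w b × φ b ≡ v₀Edge u w b)) →
  (∀ b → ¬ (c₁ ≡ v₁Edge u w b × φ b ≡ v₁Edge u w b)) →
  Feasible (extend C u w) (c₀ ∷ c₁ ∷ φ)
extend-feasible F ok₀₁ ok₀ ok₁ zero          zero          v≢v _ = v≢v refl
extend-feasible F ok₀₁ ok₀ ok₁ zero          (suc zero)    _     = ok₀₁
extend-feasible F ok₀₁ ok₀ ok₁ zero          (suc (suc b)) _     = ok₀ b
extend-feasible F ok₀₁ ok₀ ok₁ (suc zero)    zero          _     = ok₀₁ ∘ swap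
extend-feasible F ok₀₁ ok₀ ok₁ (suc zero)    (suc zero)    v≢v _ = v≢v refl
extend-feasible F ok₀₁ ok₀ ok₁ (suc zero)    (suc (suc b)) _     = ok₁ b
extend-feasible F ok₀₁ ok₀ ok₁ (suc (suc a)) zero          _     = ok₀ a ∘ swap
extend-feasible F ok₀₁ ok₀ ok₁ (suc (suc a)) (suc zero)    _     = ok₁ a ∘ swap
extend-feasible F ok₀₁ ok₀ ok₁ (suc (suc a)) (suc (suc b)) a≢b   = F a b (a≢b ∘ cong (suc ∘ suc))

module _ {n : ℕ} {C : EdgeColouring n} {u w : Fin n} {φ : Fin n → Colour} (F : Feasible C φ) where

  extend-feasible-v₀X : φ u ≢ X → Feasible (extend C u w) (X ∷ Z ∷ φ)
  extend-feasible-v₀X φu≢X = extend-feasible F (λ ()) v₀-ok (λ b → v₁Edge≢Z u w b ∘ sym ∘ proj₁)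
    where
    v₀-ok : ∀ b → ¬ (X ≡ v₀Edge u w b × φ b ≡ v₀Edge u w b)
    v₀-ok b (X≡e , φb≡e) with v₀Edge≡X⇒≡ u w (sym X≡e)
    ... | refl = φu≢X (trans φb≡e (sym X≡e))

  extend-feasible-v₁X : φ w ≢ X → Feasible (extend C u w) (Z ∷ X ∷ φ)
  extend-feasible-v₁X φw≢X = extend-feasible F (λ ()) (λ b → v₀Edge≢Z u w b ∘ sym ∘ proj₁) v₁-ok
    where
    v₁-ok : ∀ b → ¬ (X ≡ v₁Edge u w b × φ b ≡ v₁Edge u w b)
    v₁-ok b (X≡e , φb≡e) with v₁Edge≡X⇒≡ u w (sym X≡e)
    ... | refl = φw≢X (trans φb≡e (sym X≡e))

extend-feasible⇒u≢X⊎w≢X : ∀ {n} {C : EdgeColouring n} {g₁ g₂ g₃ g₄ u w : Fin n} →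
  TypeOneYGadget C g₁ g₂ g₃ g₄ →
  u ≢ g₁ → u ≢ g₂ → u ≢ g₃ → u ≢ g₄ → w ≢ g₁ → w ≢ g₂ → w ≢ g₃ → w ≢ g₄ →
  ∀ {ψ} → Feasible (extend C u w) ψ → ψ (suc (suc u)) ≢ X ⊎ ψ (suc (suc w)) ≢ X
extend-feasible⇒u≢X⊎w≢X {u = u} {w} G u≢g₁ u≢g₂ u≢g₃ u≢g₄ w≢g₁ w≢g₂ w≢g₃ w≢g₄ {ψ} F
  with ψ zero in ψ₀ | ψ (suc zero) in ψ₁
... | X | _ = inj₁ (feasible-edge F (λ ()) (v₀Edge-self u w) ψ₀)
... | Y | _ = ⊥-elim (typeOneYGadget-Y-off G (restrict-feasible F) u≢g₁ u≢g₂ u≢g₃ u≢g₄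
                (λ a≢u → feasible-edge F (λ ()) (v₀Edge-≢ u w a≢u) ψ₀))
... | Z | X = inj₂ (feasible-edge F (λ ()) (v₁Edge-self u w) ψ₁)
... | Z | Y = ⊥-elim (typeOneYGadget-Y-off G (restrict-feasible F) w≢g₁ w≢g₂ w≢g₃ w≢g₄
                (λ a≢w → feasible-edge F (λ ()) (v₁Edge-≢ u w a≢w) ψ₁))
... | Z | Z = ⊥-elim (F zero (suc zero) (λ ()) (ψ₀ , ψ₁))

mainTheorem7 : (n : ℕ) (C : EdgeColouring n) → Symmetric C →
    (g₁ g₂ g₃ g₄ : Fin n) → TypeOneYGadget C g₁ g₂ g₃ g₄ →
    (u w : Fin n) → u ≢ w →
    u ≢ g₁ → u ≢ g₂ → u ≢ g₃ → u ≢ g₄ →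
    w ≢ g₁ → w ≢ g₂ → w ≢ g₃ → w ≢ g₄ →
    HasFeasible (extend C u w)
      ⇔ Σ (Fin n → Colour) (λ φ → Feasible C φ × (φ u ≢ X ⊎ φ w ≢ X))
mainTheorem7 n C _ g₁ g₂ g₃ g₄ G u w _ u≢g₁ u≢g₂ u≢g₃ u≢g₄ w≢g₁ w≢g₂ w≢g₃ w≢g₄ = mk⇔ restrict recolour
  where
  restrict : HasFeasible (extend C u w) → Σ (Fin n → Colour) (λ φ → Feasible C φ × (φ u ≢ X ⊎ φ w ≢ X))
  restrict (ψ , F) = tail (tail ψ) , restrict-feasible F
                   , extend-feasible⇒u≢X⊎w≢X G u≢g₁ u≢g₂ u≢g₃ u≢g₄ w≢g₁ w≢g₂ w≢g₃ w≢g₄ F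

  recolour : Σ (Fin n → Colour) (λ φ → Feasible C φ × (φ u ≢ X ⊎ φ w ≢ X)) → HasFeasible (extend C u w)
  recolour (φ , F , inj₁ φu≢X) = X ∷ Z ∷ φ , extend-feasible-v₀X F φu≢X
  recolour (φ , F , inj₂ φw≢X) = Z ∷ X ∷ φ , extend-feasible-v₁X F φw≢X
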